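{- For every execution graph $G$, thread $T$ and iteration index $q$ (for which iterations $q$ and $q+1$ exist), $\mathit{end}_G^T(q)<\mathit{start}_G^T(q+1)$.
   Context: Fix finite sets $\mathit{Register}$, $\mathit{Location}$, $\mathit{Value}$ and a finite set of threads $\mathcal T$. A state is a function $\sigma:\mathit{Register}\to\mathit{Value}$; an update is a partial function $\mu:\mathit{Register}\rightharpoonup\mathit{Value}$, and $(\sigma\ll\mu)(r)=\mu(r)$ if $r\in\mathrm{Dom}(\mu)$, else $\sigma(r)$. Events are $R^m(x)$, $W^m(x,v)$, $F^m$, and the error event $E$, with $m\in\{\mathrm{rlx},\mathrm{rel},\mathrm{acq},\mathrm{sc}\}$. A program $P$ gives each $T\in\mathcal T$ a finite sequence $P_T(0),\dots,P_T(|P_T|-1)$ of statements, each either $\mathtt{step}(\epsilon,\delta)$ with $\epsilon:\mathit{State}\to\mathit{Event}$, $\delta:\mathit{State}\times(\mathit{Value}\cup\{\bot\})\to\mathit{Update}$, or $\mathtt{await}(n,\kappa)$ with $n\in\mathbb N$, $\kappa:\mathit{State}\to\{0,1\}$; whenever $P_T(k)=\mathtt{await}(n,\kappa)$ we have $n\le k$ and no $P_T(k')$ with $k'\in[k-n,k)$ is an await. An execution graph $G$ consists of a set $G.\mathrm{E}$ of triples $\langle T,t,e\rangle$ (thread, index, event), a reads-from relation $G.\mathrm{rf}$ (each read has at most one incoming edge from a write; $G.\mathrm{rf}(r)$ is that write or $\bot$), and a modification order; $w.\mathrm{val}$ is the value of write $w$. Thread-local semantics relative to $G$: $k_G^T(0)=0$,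 $\sigma_G^T(0)$ a fixed initial state. If $k_G^T(t)\ge|P_T|$ or no triple $\langle T,t,\cdot\rangle$ is in $G.\mathrm{E}$, then the number of steps is $N_G^T=t$. Otherwise step $t$ executes $S=P_T(k_G^T(t))$. If $S=\mathtt{await}(n,\kappa)$: $e_G^T(t)=F^{\mathrm{rlx}}$, $\sigma_G^T(t+1)=\sigma_G^T(t)$, and $k_G^T(t+1)=k_G^T(t)+1$ if $\kappa(\sigma_G^T(t))=0$, else $k_G^T(t)-n$. If $S=\mathtt{step}(\epsilon,\delta)$: $e_G^T(t)=\epsilon(\sigma_G^T(t))$, $k_G^T(t+1)=k_G^T(t)+1$; $v_G^T(t)$ is the value of the write $G.\mathrm{rf}(\langle T,t,e_G^T(t)\rangle)$ if $e_G^T(t)$ is a read with an incoming rf-edge, else $\bot$; if $e_G^T(t)$ is not a read or $v_G^T(t)\neq\bot$ then $\sigma_G^T(t+1)=\sigma_G^T(t)\ll\delta(\sigma_G^T(t),v_G^T(t))$, otherwise $\sigma_G^T(t+1)=\sigma_G^T(t)$ and $N_G^T=t+1$. Await iterations: $\mathit{end}_G^T(0)<\mathit{end}_G^T(1)<\cdots$ enumerate the steps $t$ at which $P_T(k_G^T(t))$ is an await; $\mathit{len}_G^T(q)=n$ where $P_T(k_G^T(\mathit{end}_G^T(q)))=\mathtt{await}(n,\kappa)$; $\mathit{start}_G^T(q)=\mathit{end}_G^T(q)-\mathit{len}_G^T(q)$. -}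

module Defs where

open import Data.Nat using (ℕ; zero; suc; _∸_; _≤_; _<_; _+_; _≡ᵇ_)
open import Data.Fin using (Fin; _≟_)
open import Data.Bool using (Bool; true; false; _∧_; if_then_else_)
open import Data.Maybe using (Maybe; just; nothing; fromMaybe; _>>=_)
open import Data.List using (List)
open import Data.Bool.ListAction using (any)
open import Data.Product using (_×_; _,_)
open import Relation.Nullary using (¬_)
open import Relation.Nullary.Decidable using (⌊_⌋)
open import Relation.Binary.PropositionalEquality using (_≡_)

-- Finite sets are modelled as Fin n:
--   Register = Fin nR, Location = Fin nL, Value = Fin nV, threads = Fin nT.

data Mode : Set where
  rlx rel acq sc : Mode

data Event (nL nV : ℕ) : Set where
  R  : Mode → Fin nL → Event nL nV
  W  : Mode → Fin nL → Fin nV → Event nL nV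
  F  : Mode → Event nL nV
  Err : Event nL nV

State : ℕ → ℕ → Set
State nR nV = Fin nR → Fin nV

Update : ℕ → ℕ → Set
Update nR nV = Fin nR → Maybe (Fin nV)

_≪_ : ∀ {nR nV} → State nR nV → Update nR nV → State nR nV
(σ ≪ μ) r = fromMaybe (σ r) (μ r)

-- statements; Value ∪ {⊥} is Maybe Value, {0,1} is Bool (true = 1)
data Stmt (nR nL nV : ℕ) : Set where
  step  : (State nR nV → Event nL nV) →
          (State nR nV → Maybe (Fin nV) → Update nR nV) → Stmt nR nL nV
  await : ℕ → (State nR nV → Bool) → Stmt nR nL nV

lookupStmt : ∀ {nR nL nV} → List (Stmt nR nL nV) → ℕ → Maybe (Stmt nR nL nV)
lookupStmt List.[] k = nothing
lookupStmt (s List.∷ ss) zero = just s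
lookupStmt (s List.∷ ss) (suc k) = lookupStmt ss k

Program : ℕ → ℕ → ℕ → ℕ → Set
Program nR nL nV nT = Fin nT → List (Stmt nR nL nV)

WellFormed : ∀ {nR nL nV nT} → Program nR nL nV nT → Set
WellFormed {nR} {nL} {nV} {nT} P =
  ∀ (T : Fin nT) (k n : ℕ) (κ : State nR nV → Bool) →
  lookupStmt (P T) k ≡ just (await n κ) →
  (n ≤ k) ×
  (∀ (k' n' : ℕ) (κ' : State nR nV → Bool) → k ∸ n ≤ k' → k' < k →
     ¬ (lookupStmt (P T) k' ≡ just (await n' κ')))

record GEvent (nL nV nT : ℕ) : Set where
  constructor ⟨_,_,_⟩
  field
    thread : Fin nT
    index  : ℕ
    event  : Event nL nV

-- execution graphs: events, reads-from (each read at most one incoming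
-- write: a partial function from reads to writes), modification order
record ExecGraph (nL nV nT : ℕ) : Set where
  field
    E  : List (GEvent nL nV nT)
    rf : GEvent nL nV nT → Maybe (GEvent nL nV nT)
    mo : List (GEvent nL nV nT × GEvent nL nV nT)

val : ∀ {nL nV nT} → GEvent nL nV nT → Maybe (Fin nV)
val ⟨ _ , _ , W _ _ v ⟩ = just v
val _ = nothing

isRead : ∀ {nL nV} → Event nL nV → Bool
isRead (R _ _) = true
isRead _ = false

hasStep : ∀ {nL nV nT} → ExecGraph nL nV nT → Fin nT → ℕ → Bool
hasStep G T t =
  any (λ x → ⌊ GEvent.thread x ≟ T ⌋ ∧ (GEvent.index x ≡ᵇ t)) (ExecGraph.E G)

-- configuration of thread T before step t: live = false means t ≥ N_G^T
record Conf (nR nV : ℕ) : Set where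
  constructor conf
  field
    live : Bool
    pc   : ℕ
    st   : State nR nV

module Semantics {nR nL nV nT : ℕ} (P : Program nR nL nV nT)
                 (σ₀ : State nR nV) (G : ExecGraph nL nV nT) (T : Fin nT) where

  curStmt : Conf nR nV → ℕ → Maybe (Stmt nR nL nV)
  curStmt (conf true k σ) t =
    if hasStep G T t then lookupStmt (P T) k else nothing
  curStmt (conf false k σ) t = nothing

  readStep : ℕ → ℕ → State nR nV → (State nR nV → Maybe (Fin nV) → Update nR nV) →
             Event nL nV → Conf nR nV
  readStep t k σ δ e with isRead e
  ... | false = conf true (suc k) (σ ≪ δ σ nothing)
  ... | true with ExecGraph.rf G ⟨ T , t , e ⟩ >>= val
  ...   | nothing = conf false (suc k) σ
  ...   | just v  = conf true (suc k) (σ ≪ δ σ (just v))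

  next : ℕ → Conf nR nV → Conf nR nV
  next t c with curStmt c t
  ... | nothing = conf false (Conf.pc c) (Conf.st c)
  ... | just (await n κ) =
        conf true (if κ (Conf.st c) then Conf.pc c ∸ n else suc (Conf.pc c)) (Conf.st c)
  ... | just (step ε δ) = readStep t (Conf.pc c) (Conf.st c) δ (ε (Conf.st c))

  -- (live, k_G^T(t), σ_G^T(t))
  config : ℕ → Conf nR nV
  config zero = conf true zero σ₀
  config (suc t) = next t (config t)

  awaitAt : ℕ → Maybe ℕ
  awaitAt t with curStmt (config t) t
  ... | just (await n κ) = just n
  ... | _ = nothing

  isAwaitStep : ℕ → Bool
  isAwaitStep t with awaitAt t
  ... | just _ = true
  ... | nothing = false

  awaitsBefore : ℕ → ℕ
  awaitsBefore zero = zero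
  awaitsBefore (suc t) = awaitsBefore t + (if isAwaitStep t then 1 else 0)

  IsEnd : ℕ → ℕ → Set
  IsEnd q t = (isAwaitStep t ≡ true) × (awaitsBefore t ≡ q)

  lenAt : ℕ → ℕ
  lenAt t = fromMaybe zero (awaitAt t)

  -- start_G^T(q) where t = end_G^T(q)
  startAt : ℕ → ℕ
  startAt t = t ∸ lenAt t

{-# OPTIONS --safe #-}
module Submission where

open import Defs
open import Data.Nat
open import Data.Nat.Properties
open import Data.Fin using (Fin)
open import Data.Bool using (Bool; true; false; if_then_else_)
open import Data.Maybe using (just; nothing; _>>=_)
open import Data.Product using (∃-syntax; _,_; proj₁; proj₂; map₂)
open import Data.Sum using (_⊎_; inj₁; inj₂)
open import Data.Empty using (⊥; ⊥-elim)
open import Relation.Nullary using (yes; no)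
open import Relation.Binary.Definitions using (tri<; tri≈; tri>)
open import Relation.Binary.PropositionalEquality

-- Between the q-th and the (q+1)-th await step the thread executes only
-- straight-line statements, so if d steps separate the two awaits then
-- the program counter advances by exactly d from where the first await
-- sent it (one past itself, or back to the start of its loop body).
-- Well-formedness forbids an await inside the loop body of another one,
-- which forces the body of the second await to have length at most d; its
-- start therefore lies strictly after the first await.

module _ {nR nL nV nT} (P : Program nR nL nV nT) (wf : WellFormed P) (T : Fin nT) where

  -- If n > d, the window [k₁ ∸ n, k₁) of the second await reaches back to
  -- the point k' where control left the first await, and whichever of the
  -- two awaits comes later in the program has the other in its window.
  await-length≤gap : ∀ {k₀ n₀ κ₀ k₁ n κ k' d} →
                     lookupStmt (P T) k₀ ≡ just (await n₀ κ₀) →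
                     lookupStmt (P T) k₁ ≡ just (await n κ) →
                     k' ≡ suc k₀ ⊎ k' ≡ k₀ ∸ n₀ →
                     k₁ ≡ d + k' →
                     n ≤ d
  await-length≤gap {k₀} {n₀} {κ₀} {k₁} {n} {κ} {k'} {d} at₀ at₁ exit refl with n ≤? d
  ... | yes n≤d = n≤d
  ... | no n≰d = ⊥-elim (contradiction exit)
    where
    d<n : d < n
    d<n = ≰⇒> n≰d

    contradiction : k' ≡ suc k₀ ⊎ k' ≡ k₀ ∸ n₀ → ⊥
    contradiction (inj₁ refl) = proj₂ (wf T k₁ n κ at₁) k₀ n₀ κ₀ k₀-in-window (m≤n+m (suc k₀) d) at₀
      where
      k₀-in-window : (d + suc k₀) ∸ n ≤ k₀
      k₀-in-window = m≤n+o⇒m∸n≤o (d + suc k₀) n (≤-trans (≤-reflexive (+-suc d k₀)) (+-monoˡ-≤ k₀ d<n))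
    contradiction (inj₂ refl) with <-cmp k₀ k₁
    ... | tri< k₀<k₁ _ _ = proj₂ (wf T k₁ n κ at₁) k₀ n₀ κ₀ k₀-in-window k₀<k₁ at₀
      where
      k₀-in-window : (d + (k₀ ∸ n₀)) ∸ n ≤ k₀
      k₀-in-window = ≤-trans (m≤n+o⇒m∸n≤o (d + (k₀ ∸ n₀)) n (+-monoˡ-≤ (k₀ ∸ n₀) (<⇒≤ d<n))) (m∸n≤m k₀ n₀)
    ... | tri> _ _ k₁<k₀ = proj₂ (wf T k₀ n₀ κ₀ at₀) k₁ n κ (m≤n+m (k₀ ∸ n₀) d) k₁<k₀ at₁
    ... | tri≈ _ k₀≡k₁ _ with trans (sym at₀) (trans (cong (lookupStmt (P T)) k₀≡k₁) at₁)
    ...   | refl = <-irrefl (sym k₀≡k₁) (begin-strict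
              d + (k₀ ∸ n)  <⟨ +-monoˡ-< (k₀ ∸ n) d<n ⟩
              n + (k₀ ∸ n)  ≡⟨ m+[n∸m]≡n (proj₁ (wf T k₀ n κ at₀)) ⟩
              k₀            ∎)
      where open ≤-Reasoning

module Run {nR nL nV nT} (P : Program nR nL nV nT) (σ₀ : State nR nV)
           (G : ExecGraph nL nV nT) (T : Fin nT) where
  open Semantics P σ₀ G T

  pc : ℕ → ℕ
  pc t = Conf.pc (config t)

  live : ℕ → Bool
  live t = Conf.live (config t)

  curStmt-lookup : ∀ c t {s} → curStmt c t ≡ just s → lookupStmt (P T) (Conf.pc c) ≡ just s
  curStmt-lookup (conf true _ _) t eq with hasStep G T t
  ... | true = eq
  curStmt-lookup (conf true _ _) t () | false
  curStmt-lookup (conf false _ _) t ()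

  curStmt-live : ∀ c t {s} → curStmt c t ≡ just s → Conf.live c ≡ true
  curStmt-live (conf true _ _) t _ = refl
  curStmt-live (conf false _ _) t ()

  live-of-next : ∀ t c → Conf.live (next t c) ≡ true → Conf.live c ≡ true
  live-of-next t (conf true _ _) _ = refl
  live-of-next t (conf false _ _) ()

  await-step-view : ∀ t → isAwaitStep t ≡ true → ∃[ κ ] curStmt (config t) t ≡ just (await (lenAt t) κ)
  await-step-view t isAwait with curStmt (config t) t
  ... | just (await n κ) = κ , refl
  await-step-view t () | just (step _ _)
  await-step-view t () | nothing

  await-step-lookup : ∀ t → isAwaitStep t ≡ true → ∃[ κ ] lookupStmt (P T) (pc t) ≡ just (await (lenAt t) κ)
  await-step-lookup t isAwait = map₂ (curStmt-lookup (config t) t) (await-step-view t isAwait)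

  await-step-live : ∀ t → isAwaitStep t ≡ true → live t ≡ true
  await-step-live t isAwait = curStmt-live (config t) t (proj₂ (await-step-view t isAwait))

  pc-after-await : ∀ t → isAwaitStep t ≡ true → pc (suc t) ≡ suc (pc t) ⊎ pc (suc t) ≡ pc t ∸ lenAt t
  pc-after-await t isAwait with await-step-view t isAwait
  ... | κ , at rewrite at with κ (Conf.st (config t))
  ... | true = inj₂ refl
  ... | false = inj₁ refl

  readStep-pc : ∀ t k σ δ e → Conf.pc (readStep t k σ δ e) ≡ suc k
  readStep-pc t k σ δ e with isRead e
  ... | false = refl
  ... | true with ExecGraph.rf G ⟨ T , t , e ⟩ >>= val
  ...   | nothing = refl
  ...   | just _ = refl

  pc-after-non-await : ∀ t → isAwaitStep t ≡ false → live (suc t) ≡ true → pc (suc t) ≡ suc (pc t)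
  pc-after-non-await t notAwait isLive with curStmt (config t) t
  ... | just (step ε δ) = readStep-pc t (pc t) (Conf.st (config t)) δ (ε (Conf.st (config t)))
  pc-after-non-await t () isLive | just (await _ _)
  pc-after-non-await t notAwait () | nothing

  pc-straight-line : ∀ t d → (∀ i → i < d → isAwaitStep (i + t) ≡ false) →
                     live (d + t) ≡ true → pc (d + t) ≡ d + pc t
  pc-straight-line t zero _ _ = refl
  pc-straight-line t (suc d) notAwait isLive =
    begin
      pc (suc d + t)    ≡⟨ pc-after-non-await (d + t) (notAwait d ≤-refl) isLive ⟩
      suc (pc (d + t))  ≡⟨ cong suc (pc-straight-line t d (λ i i<d → notAwait i (m<n⇒m<1+n i<d))
                                                        (live-of-next (d + t) (config (d + t)) isLive)) ⟩
      suc d + pc t      ∎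
    where open ≡-Reasoning

  awaitsBefore-mono : ∀ {s t} → s ≤ t → awaitsBefore s ≤ awaitsBefore t
  awaitsBefore-mono {t = zero} z≤n = ≤-refl
  awaitsBefore-mono {t = suc t} s≤1+t with m≤n⇒m<n∨m≡n s≤1+t
  ... | inj₁ s<1+t = ≤-trans (awaitsBefore-mono (s≤s⁻¹ s<1+t)) (m≤m+n _ _)
  ... | inj₂ refl = ≤-refl

  awaitsBefore-strict : ∀ {s t} → isAwaitStep s ≡ true → s < t → awaitsBefore s < awaitsBefore t
  awaitsBefore-strict {s} {t} isAwait s<t = begin-strict
    awaitsBefore s        <⟨ m<m+n (awaitsBefore s) z<s ⟩
    awaitsBefore s + 1    ≡⟨ cong (λ b → awaitsBefore s + (if b then 1 else 0)) (sym isAwait) ⟩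
    awaitsBefore (suc s)  ≤⟨ awaitsBefore-mono s<t ⟩
    awaitsBefore t        ∎
    where open ≤-Reasoning

  module _ {q e₀ e₁} (end₀ : IsEnd q e₀) (end₁ : IsEnd (suc q) e₁) where

    consecutive-ends : ∃[ d ] e₁ ≡ d + suc e₀
    consecutive-ends = e₁ ∸ suc e₀ , sym (m∸n+n≡m e₀<e₁)
      where
      e₀<e₁ : e₀ < e₁
      e₀<e₁ = ≰⇒> λ e₁≤e₀ → 1+n≰n (subst₂ _≤_ (proj₂ end₁) (proj₂ end₀) (awaitsBefore-mono e₁≤e₀))

    no-await-between-ends : ∀ {t} → e₀ < t → t < e₁ → isAwaitStep t ≡ false
    no-await-between-ends {t} e₀<t t<e₁ with isAwaitStep t in isAwait
    ... | false = refl
    ... | true = ⊥-elim (<⇒≱ q<t (s≤s⁻¹ t<1+q))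
      where
      q<t : q < awaitsBefore t
      q<t = subst (_< awaitsBefore t) (proj₂ end₀) (awaitsBefore-strict (proj₁ end₀) e₀<t)
      t<1+q : awaitsBefore t < suc q
      t<1+q = subst (awaitsBefore t <_) (proj₂ end₁) (awaitsBefore-strict isAwait t<e₁)

lemma3 : ∀ {nR nL nV nT : ℕ} (P : Program nR nL nV nT) → WellFormed P →
    (σ₀ : State nR nV) (G : ExecGraph nL nV nT) (T : Fin nT) (q e₀ e₁ : ℕ) →
    Semantics.IsEnd P σ₀ G T q e₀ →
    Semantics.IsEnd P σ₀ G T (suc q) e₁ →
    e₀ < Semantics.startAt P σ₀ G T e₁
lemma3 P wf σ₀ G T q e₀ e₁ end₀@(isAwait₀ , _) end₁@(isAwait₁ , _)
  with Run.consecutive-ends P σ₀ G T {q} {e₀} {e₁} end₀ end₁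
... | d , refl = begin-strict
    e₀                <⟨ m≤n+m (suc e₀) (d ∸ n) ⟩
    (d ∸ n) + suc e₀  ≡⟨ +-∸-comm (suc e₀) n≤d ⟨
    (d + suc e₀) ∸ n  ∎
  where
  open Semantics P σ₀ G T
  open Run P σ₀ G T
  open ≤-Reasoning

  n : ℕ
  n = lenAt (d + suc e₀)

  straight-line : pc (d + suc e₀) ≡ d + pc (suc e₀)
  straight-line = pc-straight-line (suc e₀) d
    (λ i i<d → no-await-between-ends {q} {e₀} end₀ end₁ (m≤n+m (suc e₀) i) (+-monoˡ-< (suc e₀) i<d))
    (await-step-live (d + suc e₀) isAwait₁)

  n≤d : n ≤ d
  n≤d = await-length≤gap P wf T (proj₂ (await-step-lookup e₀ isAwait₀))
                                (proj₂ (await-step-lookup (d + suc e₀) isAwait₁))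
                                (pc-after-await e₀ isAwait₀) straight-line
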